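{- Let $n\ge 1$ be an integer and let $S=\langle \binom{n+1}{2},\binom{n+2}{2},\binom{n+3}{2},\binom{n+4}{2}\rangle$. Then the Frobenius number of $S$ is: $$ F(S)=\begin{cases} \frac{1}{3} n^3 + \frac{11}{6} n^2 + \frac{5}{2} n - 1 & \text{if } n \equiv 0 \pmod{6},\ n \ge 6,\\ \frac{1}{3} n^3 + \frac{5}{3} n^2 + \frac{10}{3} n + 1 & \text{if } n \equiv 2 \pmod{6},\ n \ge 2,\\ \frac{1}{3} n^3 + \frac{3}{2} n^2 + \frac{13}{6} n & \text{if } n \equiv 4 \pmod{6},\ n \ge 4,\\ \frac{1}{2} n^3 + \frac{3}{2} n^2 - 3 & \text{if } n \equiv 1 \pmod{6},\ n \ge 1,\\ \frac{1}{2} n^3 + 2 n^2 + \frac{1}{2} n - 4 & \text{if } n \equiv 3 \pmod{6},\ n \ge 3,\\ \frac{1}{2} n^3 + 2 n^2 + \frac{5}{2} n & \text{if } n \equiv 5 \pmod{6},\ n \ge 5. \end{cases} $$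
   Context: $\langle a_1,\dots,a_m\rangle$ denotes the numerical semigroup of all nonnegative integer combinations of $a_1,\dots,a_m$ (with $\gcd=1$). The Frobenius number $F(S)$ is the largest integer not in $S$. -}

module Defs where

open import Data.Nat as ℕ using (ℕ)
open import Data.Nat.Combinatorics using (_C_)
open import Data.Integer using (ℤ; +_; _<_)
open import Data.Product using (∃; _×_)
open import Relation.Binary.PropositionalEquality using (_≡_)
open import Relation.Nullary using (¬_)

InSemigroup4 : ℕ → ℕ → ℕ → ℕ → ℤ → Set
InSemigroup4 a₁ a₂ a₃ a₄ z =
  ∃ λ x₁ → ∃ λ x₂ → ∃ λ x₃ → ∃ λ x₄ →
    z ≡ + (x₁ ℕ.* a₁ ℕ.+ x₂ ℕ.* a₂ ℕ.+ x₃ ℕ.* a₃ ℕ.+ x₄ ℕ.* a₄)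

IsFrobeniusNumber : (ℤ → Set) → ℤ → Set
IsFrobeniusNumber S f = ¬ S f × (∀ z → f < z → S z)

S-n : ℕ → ℤ → Set
S-n n = InSemigroup4 ((n ℕ.+ 1) C 2) ((n ℕ.+ 2) C 2) ((n ℕ.+ 3) C 2) ((n ℕ.+ 4) C 2)

module Submission where

-- Even n = 2h, u = 2h + 1: the generators are u h, u (h + 1), a₃ = u (h + 2) + 1 and
-- a₄ = u (h + 3) + 3.  Write a number as e a₃ + w a₄ + M u with e ≤ 2 and 3w + e < u; then
-- e a₃ + w a₄ is the cheapest element of ⟨a₃, a₄⟩ in its residue class modulo u.  The number lies
-- in S when M lies in ⟨h, h + 1, 2h + 3⟩, where 2h + 3 pays for trading one a₄ for three a₃ (at
-- most w times), and the gaps R + A h (R < h) of that semigroup are exactly those with 3A < 2R.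
-- So F(S) is the largest such e a₃ + w a₄ plus u times the largest gap h - 1 + A h, and all other
-- non-members are checked to lie below it.
-- Odd n = 2g + 1, v = 2g + 3: the generators are o₁ = v g + 1, v (g + 1), v (g + 2) and o₁ + 3v.
-- A number β o₁ + M v (β < v) lies in S when M lies in ⟨g + 1, g + 2, 3⟩ using at most β threes,
-- and F(S) = (v - 1) o₁ + F(⟨3, g + 1, g + 2⟩) v.
-- The six closed forms come from the residue of h, resp. g, modulo 3.

module Frobenius where

  open import Defs
  open import Data.Nat
  open import Data.Nat.Properties
  open import Data.Nat.DivMod using (_%_; _/_; m≡m%n+[m/n]*n; m%n<n; [m+kn]%n≡m%n; m<n⇒m%n≡m)
  open import Data.Nat.Combinatorics using (_C_; nC1≡n; nCk+nC[k+1]≡[n+1]C[k+1])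
  open import Data.Nat.Tactic.RingSolver using (solve-∀)
  open import Data.Integer as ℤ using ()
  open import Data.Integer.Properties using (+-injective)
  open import Data.Product using (∃; _×_; _,_; proj₁)
  open import Data.Sum using (_⊎_; inj₁; inj₂)
  open import Data.Empty using (⊥-elim)
  open import Function using (_∘_)
  open import Relation.Nullary using (¬_; yes; no)
  open import Relation.Binary.PropositionalEquality

  m+o≡n⇒m≤n : ∀ {m n} o → m + o ≡ n → m ≤ n
  m+o≡n⇒m≤n {m} o refl = m≤m+n m o

  3m≤3n+o⇒m≤n : ∀ {m n o} → 3 * m ≤ 3 * n + o → o < 3 → m ≤ n
  3m≤3n+o⇒m≤n {m} {n} {o} le o<3 = s≤s⁻¹ (*-cancelˡ-< 3 m (suc n) (begin-strict
    3 * m        ≤⟨ le ⟩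
    3 * n + o    <⟨ +-monoʳ-< (3 * n) o<3 ⟩
    3 * n + 3    ≡⟨ +-comm (3 * n) 3 ⟩
    3 + 3 * n    ≡⟨ *-suc 3 n ⟨
    3 * suc n    ∎))
    where open ≤-Reasoning

  remainder-unique : ∀ {b r r′ q q′} .{{_ : NonZero b}} →
    r < b → r′ < b → r + q * b ≡ r′ + q′ * b → r ≡ r′ × q ≡ q′
  remainder-unique {b} {r} {r′} {q} {q′} r<b r′<b eq = r≡r′ , q≡q′
    where
    open ≡-Reasoning
    r≡r′ : r ≡ r′
    r≡r′ = begin
      r                  ≡⟨ m<n⇒m%n≡m r<b ⟨
      r % b              ≡⟨ [m+kn]%n≡m%n r q b ⟨
      (r + q * b) % b    ≡⟨ cong (_% b) eq ⟩
      (r′ + q′ * b) % b  ≡⟨ [m+kn]%n≡m%n r′ q′ b ⟩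
      r′ % b             ≡⟨ m<n⇒m%n≡m r′<b ⟩
      r′                 ∎
    q≡q′ : q ≡ q′
    q≡q′ = *-cancelʳ-≡ q q′ b (+-cancelˡ-≡ r _ _ (trans eq (cong (_+ q′ * b) (sym r≡r′))))

  remainder-mismatch : ∀ {b r r′ q q′} .{{_ : NonZero b}} →
    r < b → r′ < b → r ≢ r′ → r + q * b ≢ r′ + q′ * b
  remainder-mismatch {q = q} {q′} r<b r′<b r≢r′ eq =
    r≢r′ (proj₁ (remainder-unique {q = q} {q′} r<b r′<b eq))

  residue-or-overflow : ∀ {b t I β Q} .{{_ : NonZero b}} →
    β < b → t + I * b ≡ β + Q * b → (t ≡ β × I ≡ Q) ⊎ β + b ≤ t
  residue-or-overflow {b} {t} {I} {β} {Q} β<b eq with t <? b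
  ... | yes t<b = inj₁ (remainder-unique t<b β<b eq)
  ... | no t≮b with m≤n⇒∃[o]m+o≡n (≮⇒≥ t≮b)
  ...   | t′ , refl = inj₂ (subst (_≤ b + t′) (+-comm b β) (+-monoʳ-≤ b β≤t′))
    where
    shift : ∀ t′ I b → t′ + (1 + I) * b ≡ b + t′ + I * b
    shift = solve-∀
    β≤t′ : β ≤ t′
    β≤t′ with t′ <? b
    ... | yes t′<b =
      ≤-reflexive (sym (proj₁ (remainder-unique {q = 1 + I} {q′ = Q} t′<b β<b (trans (shift t′ I b) eq))))
    ... | no t′≮b = ≤-trans (<⇒≤ β<b) (≮⇒≥ t′≮b)

  data Mod3 : ℕ → Set where
    3j+0 : ∀ j → Mod3 (j * 3)
    3j+1 : ∀ j → Mod3 (1 + j * 3)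
    3j+2 : ∀ j → Mod3 (2 + j * 3)

  mod3 : ∀ n → Mod3 n
  mod3 zero = 3j+0 0
  mod3 (suc n) with mod3 n
  ... | 3j+0 j = 3j+1 j
  ... | 3j+1 j = 3j+2 j
  ... | 3j+2 j = 3j+0 (suc j)

  InSemigroup4ℕ : ℕ → ℕ → ℕ → ℕ → ℕ → Set
  InSemigroup4ℕ a₁ a₂ a₃ a₄ z =
    ∃ λ x₁ → ∃ λ x₂ → ∃ λ x₃ → ∃ λ x₄ → z ≡ x₁ * a₁ + x₂ * a₂ + x₃ * a₃ + x₄ * a₄

  representable-after-run : ∀ {a₁ a₂ a₃ a₄} F .{{_ : NonZero a₁}} →
    (∀ r → r < a₁ → InSemigroup4ℕ a₁ a₂ a₃ a₄ (suc F + r)) →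
    ∀ z → F < z → InSemigroup4ℕ a₁ a₂ a₃ a₄ z
  representable-after-run {a₁} {a₂} {a₃} {a₄} F run z F<z with m≤n⇒∃[o]m+o≡n F<z
  ... | k , refl with run (k % a₁) (m%n<n k a₁)
  ...   | x₁ , x₂ , x₃ , x₄ , eq = x₁ + k / a₁ , x₂ , x₃ , x₄ , (begin
    suc F + k                                              ≡⟨ cong (λ k → suc F + k) (m≡m%n+[m/n]*n k a₁) ⟩
    suc F + (k % a₁ + (k / a₁) * a₁)                       ≡⟨ +-assoc (suc F) (k % a₁) _ ⟨
    suc F + k % a₁ + (k / a₁) * a₁                         ≡⟨ cong (_+ (k / a₁) * a₁) eq ⟩
    x₁ * a₁ + x₂ * a₂ + x₃ * a₃ + x₄ * a₄ + (k / a₁) * a₁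
      ≡⟨ identity x₁ x₂ x₃ x₄ (k / a₁) a₁ a₂ a₃ a₄ ⟩
    (x₁ + k / a₁) * a₁ + x₂ * a₂ + x₃ * a₃ + x₄ * a₄       ∎)
    where
    open ≡-Reasoning
    identity : ∀ x₁ x₂ x₃ x₄ q a₁ a₂ a₃ a₄ →
      x₁ * a₁ + x₂ * a₂ + x₃ * a₃ + x₄ * a₄ + q * a₁ ≡ (x₁ + q) * a₁ + x₂ * a₂ + x₃ * a₃ + x₄ * a₄
    identity = solve-∀

  frobenius-from-ℕ : ∀ {a₁ a₂ a₃ a₄} F →
    ¬ InSemigroup4ℕ a₁ a₂ a₃ a₄ F → (∀ z → F < z → InSemigroup4ℕ a₁ a₂ a₃ a₄ z) →
    IsFrobeniusNumber (InSemigroup4 a₁ a₂ a₃ a₄) (ℤ.+ F)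
  frobenius-from-ℕ {a₁} {a₂} {a₃} {a₄} F F∉S above = F∉S ∘ drop-+ , lift
    where
    drop-+ : InSemigroup4 a₁ a₂ a₃ a₄ (ℤ.+ F) → InSemigroup4ℕ a₁ a₂ a₃ a₄ F
    drop-+ (x₁ , x₂ , x₃ , x₄ , eq) = x₁ , x₂ , x₃ , x₄ , +-injective eq
    lift : ∀ z → ℤ.+ F ℤ.< z → InSemigroup4 a₁ a₂ a₃ a₄ z
    lift (ℤ.+ z) (ℤ.+<+ F<z) with above z F<z
    ... | x₁ , x₂ , x₃ , x₄ , eq = x₁ , x₂ , x₃ , x₄ , cong ℤ.+_ eq

  2*nC2+n≡n*n : ∀ n → 2 * (n C 2) + n ≡ n * n
  2*nC2+n≡n*n zero = refl
  2*nC2+n≡n*n (suc n) = begin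
    2 * (suc n C 2) + suc n          ≡⟨ cong (λ c → 2 * c + suc n) (nCk+nC[k+1]≡[n+1]C[k+1] n 1) ⟨
    2 * (n C 1 + n C 2) + suc n      ≡⟨ cong (λ c → 2 * (c + n C 2) + suc n) (nC1≡n n) ⟩
    2 * (n + n C 2) + suc n          ≡⟨ regroup n (n C 2) ⟩
    (2 * (n C 2) + n) + (2 * n + 1)  ≡⟨ cong (_+ (2 * n + 1)) (2*nC2+n≡n*n n) ⟩
    n * n + (2 * n + 1)              ≡⟨ square n ⟩
    suc n * suc n                    ∎
    where
    open ≡-Reasoning
    regroup : ∀ n c → 2 * (n + c) + suc n ≡ (2 * c + n) + (2 * n + 1)
    regroup = solve-∀
    square : ∀ n → n * n + (2 * n + 1) ≡ suc n * suc n
    square = solve-∀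

  2c+n≡n*n⇒nC2≡c : ∀ {n c} → 2 * c + n ≡ n * n → n C 2 ≡ c
  2c+n≡n*n⇒nC2≡c {n} {c} eq =
    *-cancelˡ-≡ (n C 2) c 2 (+-cancelʳ-≡ n _ _ (trans (2*nC2+n≡n*n n) (sym eq)))

  S-n-by-generators : ∀ {n a₁ a₂ a₃ a₄ F} →
    (n + 1) C 2 ≡ a₁ → (n + 2) C 2 ≡ a₂ → (n + 3) C 2 ≡ a₃ → (n + 4) C 2 ≡ a₄ →
    IsFrobeniusNumber (InSemigroup4 a₁ a₂ a₃ a₄) F → IsFrobeniusNumber (S-n n) F
  S-n-by-generators refl refl refl refl isF = isF

  module Even (m : ℕ) where

    h u a₁ a₂ a₃ a₄ : ℕ
    h = 2 + m
    u = 1 + 2 * h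
    a₁ = u * h
    a₂ = u * (1 + h)
    a₃ = u * (2 + h) + 1
    a₄ = u * (3 + h) + 3

    S-n-even : ∀ {F} → IsFrobeniusNumber (InSemigroup4 a₁ a₂ a₃ a₄) F → IsFrobeniusNumber (S-n (2 * h)) F
    S-n-even = S-n-by-generators {n = 2 * h}
      (2c+n≡n*n⇒nC2≡c (c₁ h)) (2c+n≡n*n⇒nC2≡c (c₂ h)) (2c+n≡n*n⇒nC2≡c (c₃ h)) (2c+n≡n*n⇒nC2≡c (c₄ h))
      where
      c₁ : ∀ h → 2 * ((1 + 2 * h) * h) + (2 * h + 1) ≡ (2 * h + 1) * (2 * h + 1)
      c₁ = solve-∀
      c₂ : ∀ h → 2 * ((1 + 2 * h) * (1 + h)) + (2 * h + 2) ≡ (2 * h + 2) * (2 * h + 2)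
      c₂ = solve-∀
      c₃ : ∀ h → 2 * ((1 + 2 * h) * (2 + h) + 1) + (2 * h + 3) ≡ (2 * h + 3) * (2 * h + 3)
      c₃ = solve-∀
      c₄ : ∀ h → 2 * ((1 + 2 * h) * (3 + h) + 3) + (2 * h + 4) ≡ (2 * h + 4) * (2 * h + 4)
      c₄ = solve-∀

    InS : ℕ → Set
    InS = InSemigroup4ℕ a₁ a₂ a₃ a₄

    cost : ℕ → ℕ → ℕ
    cost w e = (3 + h) * w + (2 + h) * e

    a₃a₄-part : ℕ → ℕ → ℕ
    a₃a₄-part w e = e * a₃ + w * a₄

    nf : ℕ → ℕ → ℕ → ℕ → ℕ
    nf A R w e = a₃a₄-part w e + (R + A * h) * u

    residue-quotient : ∀ x₁ x₂ x₃ x₄ → x₁ * a₁ + x₂ * a₂ + x₃ * a₃ + x₄ * a₄ ≡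
      (x₃ + 3 * x₄) + (x₁ * h + x₂ * (1 + h) + x₃ * (2 + h) + x₄ * (3 + h)) * u
    residue-quotient = identity h
      where
      identity : ∀ h x₁ x₂ x₃ x₄ → let u = 1 + 2 * h in
        x₁ * (u * h) + x₂ * (u * (1 + h)) + x₃ * (u * (2 + h) + 1) + x₄ * (u * (3 + h) + 3) ≡
        (x₃ + 3 * x₄) + (x₁ * h + x₂ * (1 + h) + x₃ * (2 + h) + x₄ * (3 + h)) * u
      identity = solve-∀

    nf-residue-quotient : ∀ A R w e → nf A R w e ≡ (3 * w + e) + (cost w e + (R + A * h)) * u
    nf-residue-quotient A R w e = identity h A R w e
      where
      identity : ∀ h A R w e → let u = 1 + 2 * h in
        e * (u * (2 + h) + 1) + w * (u * (3 + h) + 3) + (R + A * h) * u ≡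
        (3 * w + e) + ((3 + h) * w + (2 + h) * e + (R + A * h)) * u
      identity = solve-∀

    3[R+Ah]<[3+2h]R : ∀ {A R} → 3 * A < 2 * R → 3 * (R + A * h) < (3 + 2 * h) * R
    3[R+Ah]<[3+2h]R {A} {R} 3A<2R = begin-strict
      3 * (R + A * h)      ≡⟨ identity₁ h A R ⟩
      3 * R + (3 * A) * h  <⟨ +-monoʳ-< (3 * R) (*-monoˡ-< h 3A<2R) ⟩
      3 * R + (2 * R) * h  ≡⟨ identity₂ h R ⟩
      (3 + 2 * h) * R      ∎
      where
      open ≤-Reasoning
      identity₁ : ∀ h A R → 3 * (R + A * h) ≡ 3 * R + (3 * A) * h
      identity₁ = solve-∀
      identity₂ : ∀ h R → 3 * R + (2 * R) * h ≡ (3 + 2 * h) * R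
      identity₂ = solve-∀

    -- Three times a representation is at least (3 + 2h)(y + 3k), so y + 3k < R; but both
    -- sides have remainder R modulo h.
    R+Ah∉⟨h,1+h,3+2h⟩ : ∀ {A R} → R < h → 3 * A < 2 * R →
      ∀ x y k → x * h + y * (1 + h) + k * (3 + 2 * h) ≢ R + A * h
    R+Ah∉⟨h,1+h,3+2h⟩ {A} {R} R<h 3A<2R x y k eq = <-irrefl r≡R r<R
      where
      r = y + 3 * k
      identity₁ : ∀ h x y k →
        (3 + 2 * h) * (y + 3 * k) + (3 * x * h + y * h) ≡ 3 * (x * h + y * (1 + h) + k * (3 + 2 * h))
      identity₁ = solve-∀
      identity₂ : ∀ h x y k → (y + 3 * k) + (x + y + 2 * k) * h ≡ x * h + y * (1 + h) + k * (3 + 2 * h)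
      identity₂ = solve-∀
      r<R : r < R
      r<R = *-cancelˡ-< (3 + 2 * h) r R (begin-strict
        (3 + 2 * h) * r                              ≤⟨ m+o≡n⇒m≤n (3 * x * h + y * h) (identity₁ h x y k) ⟩
        3 * (x * h + y * (1 + h) + k * (3 + 2 * h))  ≡⟨ cong (3 *_) eq ⟩
        3 * (R + A * h)                              <⟨ 3[R+Ah]<[3+2h]R {A} {R} 3A<2R ⟩
        (3 + 2 * h) * R                              ∎)
        where open ≤-Reasoning
      r≡R : r ≡ R
      r≡R = proj₁ (remainder-unique {q = x + y + 2 * k} {q′ = A} (<-trans r<R R<h) R<h (trans (identity₂ h x y k) eq))

    3nf<a₄[β+u] : ∀ {A R w e} → e ≤ 2 → R < h → 3 * A < 2 * R → 3 * nf A R w e < a₄ * ((3 * w + e) + u)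
    3nf<a₄[β+u] {A} {R} {w} {e} e≤2 R<h 3A<2R = begin-strict
      3 * nf A R w e                                              ≡⟨ identity₁ h A R w e ⟩
      a₄ * (3 * w + e) + (e * (3 + 2 * h) + 3 * (R + A * h)) * u   <⟨ +-monoʳ-< (a₄ * (3 * w + e)) (*-monoˡ-< u
                                                                        (+-monoʳ-< (e * (3 + 2 * h)) (3[R+Ah]<[3+2h]R {A} {R} 3A<2R))) ⟩
      a₄ * (3 * w + e) + (e * (3 + 2 * h) + (3 + 2 * h) * R) * u   ≤⟨ +-monoʳ-≤ (a₄ * (3 * w + e))
                                                                        (*-monoˡ-≤ u e+R-bound) ⟩
      a₄ * (3 * w + e) + a₄ * u                                    ≡⟨ *-distribˡ-+ a₄ (3 * w + e) u ⟨
      a₄ * ((3 * w + e) + u)                                       ∎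
      where
      open ≤-Reasoning
      identity₁ : ∀ h A R w e →
        let u = 1 + 2 * h
            a₃ = u * (2 + h) + 1
            a₄ = u * (3 + h) + 3
        in 3 * (e * a₃ + w * a₄ + (R + A * h) * u) ≡ a₄ * (3 * w + e) + (e * (3 + 2 * h) + 3 * (R + A * h)) * u
      identity₁ = solve-∀
      identity₂ : ∀ h e R → e * (3 + 2 * h) + (3 + 2 * h) * R ≡ (e + R) * (3 + 2 * h)
      identity₂ = solve-∀
      identity₃ : ∀ h → (1 + h) * (3 + 2 * h) + (3 + 2 * h) ≡ (1 + 2 * h) * (3 + h) + 3
      identity₃ = solve-∀
      e+R-bound : e * (3 + 2 * h) + (3 + 2 * h) * R ≤ a₄
      e+R-bound = begin
        e * (3 + 2 * h) + (3 + 2 * h) * R  ≡⟨ identity₂ h e R ⟩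
        (e + R) * (3 + 2 * h)              ≤⟨ *-monoˡ-≤ (3 + 2 * h) (+-mono-≤ e≤2 (s≤s⁻¹ R<h)) ⟩
        (1 + h) * (3 + 2 * h)              ≤⟨ m+o≡n⇒m≤n (3 + 2 * h) (identity₃ h) ⟩
        a₄                                 ∎

    -- Equal residues force x₄ = w - k and x₃ = e + 3k, which leaves the quotient
    -- cost w e + (x₁ h + x₂ (1 + h) + k (3 + 2h)).
    matching-residue⇒quotient≢ : ∀ {A R w e x₁ x₂ x₃ x₄} → R < h → 3 * A < 2 * R → e ≤ 2 →
      x₃ + 3 * x₄ ≡ 3 * w + e → x₁ * h + x₂ * (1 + h) + x₃ * (2 + h) + x₄ * (3 + h) ≢ cost w e + (R + A * h)
    matching-residue⇒quotient≢ {A} {R} {w} {e} {x₁} {x₂} {x₃} {x₄} R<h 3A<2R e≤2 t≡β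
      with m≤n⇒∃[o]m+o≡n (3m≤3n+o⇒m≤n {x₄} {w} {e} (≤-trans (m≤n+m (3 * x₄) x₃) (≤-reflexive t≡β))
                                                  (s≤s e≤2))
    ... | k , refl with +-cancelʳ-≡ (3 * x₄) x₃ (e + 3 * k) (trans t≡β (identity₁ x₄ k e))
      where
      identity₁ : ∀ x₄ k e → 3 * (x₄ + k) + e ≡ (e + 3 * k) + 3 * x₄
      identity₁ = solve-∀
    ...   | refl = λ eq → R+Ah∉⟨h,1+h,3+2h⟩ {A} {R} R<h 3A<2R x₁ x₂ k
                     (+-cancelˡ-≡ (cost (x₄ + k) e) _ _ (trans (sym (identity₂ h x₁ x₂ x₄ k e)) eq))
      where
      identity₂ : ∀ h x₁ x₂ x₄ k e →
        x₁ * h + x₂ * (1 + h) + (e + 3 * k) * (2 + h) + x₄ * (3 + h) ≡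
        ((3 + h) * (x₄ + k) + (2 + h) * e) + (x₁ * h + x₂ * (1 + h) + k * (3 + 2 * h))
      identity₂ = solve-∀

    nf-∉ : ∀ {A R w e} → e ≤ 2 → 3 * w + e < u → R < h → 3 * A < 2 * R → ¬ InS (nf A R w e)
    nf-∉ {A} {R} {w} {e} e≤2 β<u R<h 3A<2R (x₁ , x₂ , x₃ , x₄ , eq)
      with residue-or-overflow β<u (trans (sym (residue-quotient x₁ x₂ x₃ x₄)) (trans (sym eq) (nf-residue-quotient A R w e)))
    ... | inj₁ (t≡β , I≡Q) = matching-residue⇒quotient≢ {A} {R} {w} {e} {x₁} {x₂} {x₃} {x₄} R<h 3A<2R e≤2 t≡β I≡Q
    ... | inj₂ β+u≤t = <⇒≱ (3nf<a₄[β+u] {A} {R} {w} {e} e≤2 R<h 3A<2R) (begin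
      a₄ * ((3 * w + e) + u)                       ≤⟨ *-monoʳ-≤ a₄ β+u≤t ⟩
      a₄ * (x₃ + 3 * x₄)                           ≤⟨ m+o≡n⇒m≤n _ (identity h x₁ x₂ x₃ x₄) ⟩
      3 * (x₁ * a₁ + x₂ * a₂ + x₃ * a₃ + x₄ * a₄)  ≡⟨ cong (3 *_) eq ⟨
      3 * nf A R w e                               ∎)
      where
      open ≤-Reasoning
      identity : ∀ h x₁ x₂ x₃ x₄ →
        let u = 1 + 2 * h
            a₁ = u * h
            a₂ = u * (1 + h)
            a₃ = u * (2 + h) + 1
            a₄ = u * (3 + h) + 3
        in a₄ * (x₃ + 3 * x₄) + (3 * x₁ * a₁ + 3 * x₂ * a₂ + x₃ * ((3 + 2 * h) * u)) ≡
           3 * (x₁ * a₁ + x₂ * a₂ + x₃ * a₃ + x₄ * a₄)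
      identity = solve-∀

    data Shape : ℕ → Set where
      below  : ∀ w e Q → 3 * w + e ≤ 2 * h → e ≤ 2 → Q < cost w e → Shape ((3 * w + e) + Q * u)
      normal : ∀ A R w e → 3 * w + e ≤ 2 * h → e ≤ 2 → R < h → Shape (nf A R w e)

    shape : ∀ z → Shape z
    shape z = classify {Q = z / u} {w = (z % u) / 3} (m%n<n z u) (m%n<n (z % u) 3) (m≡m%n+[m/n]*n z u)
      (trans (m≡m%n+[m/n]*n (z % u) 3) (commute ((z % u) % 3) ((z % u) / 3)))
      where
      commute : ∀ e w → e + w * 3 ≡ 3 * w + e
      commute = solve-∀
      classify : ∀ {z β Q w e} → β < u → e < 3 → z ≡ β + Q * u → β ≡ 3 * w + e → Shape z
      classify {Q = Q} {w} {e} β<u e<3 refl refl with cost w e ≤? Q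
      ... | no c≰Q = below w e Q (s≤s⁻¹ β<u) (s≤s⁻¹ e<3) (≰⇒> c≰Q)
      ... | yes c≤Q with m≤n⇒∃[o]m+o≡n c≤Q
      ...   | M , refl = subst Shape nf≡z (normal (M / h) (M % h) w e (s≤s⁻¹ β<u) (s≤s⁻¹ e<3) (m%n<n M h))
        where
        nf≡z : nf (M / h) (M % h) w e ≡ (3 * w + e) + (cost w e + M) * u
        nf≡z = trans (nf-residue-quotient (M / h) (M % h) w e)
                     (cong (λ M → (3 * w + e) + (cost w e + M) * u) (sym (m≡m%n+[m/n]*n M h)))

    a₃a₄-part-mono : ∀ {w w′ e e′} → w ≤ w′ → e ≤ e′ → a₃a₄-part w e ≤ a₃a₄-part w′ e′
    a₃a₄-part-mono w≤w′ e≤e′ = +-mono-≤ (*-monoˡ-≤ a₃ e≤e′) (*-monoˡ-≤ a₄ w≤w′)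

    below<nf : ∀ w e {Q} → Q < cost w e → (3 * w + e) + Q * u < nf 0 1 w e
    below<nf w e {Q} Q<c = begin-strict
      (3 * w + e) + Q * u               <⟨ +-monoʳ-< (3 * w + e) (*-monoˡ-< u Q<c) ⟩
      (3 * w + e) + cost w e * u        ≤⟨ +-monoʳ-≤ (3 * w + e) (*-monoˡ-≤ u (m≤m+n (cost w e) 1)) ⟩
      (3 * w + e) + (cost w e + 1) * u  ≡⟨ nf-residue-quotient 0 1 w e ⟨
      nf 0 1 w e                        ∎
      where open ≤-Reasoning

    short-max : ℕ
    short-max = 6 * a₃ + m * (3 * u + 3) + 3 * ((1 + m + m * h) * u)

    -- Where trading a₄ for three a₃ is blocked (A + w < R although 2R ≤ 3A), 3w ≤ m.
    3nf≤short-max : ∀ {A R w e} → R < h → e ≤ 2 → 2 * R ≤ 3 * A → A + w < R → 3 * nf A R w e ≤ short-max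
    3nf≤short-max {A} {R} {w} {e} R<h e≤2 2R≤3A A+w<R = begin
      3 * nf A R w e
        ≤⟨ *-monoʳ-≤ 3 (+-mono-≤ (a₃a₄-part-mono {w} {w} ≤-refl e≤2)
                                 (*-monoˡ-≤ u (+-monoˡ-≤ (A * h) (s≤s⁻¹ R<h)))) ⟩
      3 * (a₃a₄-part w 2 + (1 + m + A * h) * u)
        ≡⟨ cong (3 *_) (identity₁ m A w) ⟩
      3 * (2 * a₃ + w * (3 * u + 3) + (1 + m) * u + (A + w) * (h * u))
        ≤⟨ *-monoʳ-≤ 3 (+-monoʳ-≤ (2 * a₃ + w * (3 * u + 3) + (1 + m) * u) (*-monoˡ-≤ (h * u) A+w≤m)) ⟩
      3 * (2 * a₃ + w * (3 * u + 3) + (1 + m) * u + m * (h * u))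
        ≡⟨ identity₂ m w ⟩
      6 * a₃ + (3 * w) * (3 * u + 3) + 3 * ((1 + m + m * h) * u)
        ≤⟨ +-monoˡ-≤ (3 * ((1 + m + m * h) * u)) (+-monoʳ-≤ (6 * a₃) (*-monoˡ-≤ (3 * u + 3) 3w≤m)) ⟩
      short-max
        ∎
      where
      open ≤-Reasoning
      identity₁ : ∀ m A w →
        let h = 2 + m
            u = 1 + 2 * h
            a₃ = u * (2 + h) + 1
            a₄ = u * (3 + h) + 3
        in 2 * a₃ + w * a₄ + (1 + m + A * h) * u ≡ 2 * a₃ + w * (3 * u + 3) + (1 + m) * u + (A + w) * (h * u)
      identity₁ = solve-∀
      identity₂ : ∀ m w →
        let h = 2 + m
            u = 1 + 2 * h
            a₃ = u * (2 + h) + 1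
        in 3 * (2 * a₃ + w * (3 * u + 3) + (1 + m) * u + m * (h * u)) ≡ 6 * a₃ + (3 * w) * (3 * u + 3) + 3 * ((1 + m + m * h) * u)
      identity₂ = solve-∀
      identity₃ : ∀ R → 3 * R ≡ 2 * R + R
      identity₃ = solve-∀
      A+w≤m : A + w ≤ m
      A+w≤m = s≤s⁻¹ (<-≤-trans A+w<R (s≤s⁻¹ R<h))
      3w<R : 3 * w < R
      3w<R = +-cancelˡ-< (2 * R) (3 * w) R (begin-strict
        2 * R + 3 * w    ≤⟨ +-monoˡ-≤ (3 * w) 2R≤3A ⟩
        3 * A + 3 * w    ≡⟨ *-distribˡ-+ 3 A w ⟨
        3 * (A + w)      <⟨ *-monoʳ-< 3 A+w<R ⟩
        3 * R            ≡⟨ identity₃ R ⟩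
        2 * R + R        ∎)
      3w≤m : 3 * w ≤ m
      3w≤m = s≤s⁻¹ (<-≤-trans 3w<R (s≤s⁻¹ R<h))

    nf-∈ : ∀ A R w e → 2 * R ≤ 3 * A → R ≤ A + w → InS (nf A R w e)
    nf-∈ A R w e 2R≤3A R≤A+w with ≤-total R A
    ... | inj₁ R≤A with m≤n⇒∃[o]m+o≡n R≤A
    ...   | d , refl = d , R , e , w , identity h d R w e
      where
      identity : ∀ h d R w e →
        let u = 1 + 2 * h
            a₃ = u * (2 + h) + 1
            a₄ = u * (3 + h) + 3
        in e * a₃ + w * a₄ + (R + (R + d) * h) * u ≡ d * (u * h) + R * (u * (1 + h)) + e * a₃ + w * a₄
      identity = solve-∀
    nf-∈ A R w e 2R≤3A R≤A+w | inj₂ A≤R with m≤n⇒∃[o]m+o≡n A≤R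
    ... | k , refl
      with m≤n⇒∃[o]m+o≡n (+-cancelˡ-≤ (2 * A) (2 * k) A (subst₂ _≤_ (*-distribˡ-+ 2 A k) (identity₁ A) 2R≤3A))
      where
      identity₁ : ∀ A → 3 * A ≡ 2 * A + A
      identity₁ = solve-∀
    ...   | s , refl with m≤n⇒∃[o]m+o≡n (+-cancelˡ-≤ (2 * k + s) k w R≤A+w)
    ...     | w₁ , refl = 0 , s , e + 3 * k , w₁ , identity₂ h k s w₁ e
      where
      identity₂ : ∀ h k s w₁ e →
        let u = 1 + 2 * h
            a₃ = u * (2 + h) + 1
            a₄ = u * (3 + h) + 3
        in e * a₃ + (k + w₁) * a₄ + (2 * k + s + k + (2 * k + s) * h) * u ≡
           0 * (u * h) + s * (u * (1 + h)) + (e + 3 * k) * a₃ + w₁ * a₄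
      identity₂ = solve-∀

    a₃a₄-part-trade₁ : ∀ w e → a₃a₄-part w (1 + e) ≤ a₃a₄-part (1 + w) e
    a₃a₄-part-trade₁ w e = m+o≡n⇒m≤n (2 + u) (identity h w e)
      where
      identity : ∀ h w e →
        let u = 1 + 2 * h
            a₃ = u * (2 + h) + 1
            a₄ = u * (3 + h) + 3
        in (1 + e) * a₃ + w * a₄ + (2 + u) ≡ e * a₃ + (1 + w) * a₄
      identity = solve-∀

    a₃a₄-part-trade₂ : ∀ w e → a₃a₄-part (1 + w) e ≤ a₃a₄-part w (2 + e)
    a₃a₄-part-trade₂ w e = m+o≡n⇒m≤n (h * (3 + 2 * h)) (identity h w e)
      where
      identity : ∀ h w e →
        let u = 1 + 2 * h
            a₃ = u * (2 + h) + 1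
            a₄ = u * (3 + h) + 3
        in e * a₃ + (1 + w) * a₄ + h * (3 + 2 * h) ≡ (2 + e) * a₃ + w * a₄
      identity = solve-∀

    3w+e≤2h⇒w≤W : ∀ {w e} W c → 2 * h ≤ 3 * W + c + e → c < 3 → 3 * w + e ≤ 2 * h → w ≤ W
    3w+e≤2h⇒w≤W {w} {e} W c 2h≤ c<3 le = 3m≤3n+o⇒m≤n (+-cancelʳ-≤ e (3 * w) (3 * W + c) (≤-trans le 2h≤)) c<3

    a₃a₄-part-max₁ : ∀ {V} → 2 * h ≡ 4 + 3 * V →
      ∀ w′ e′ → 3 * w′ + e′ ≤ 2 * h → e′ ≤ 2 → a₃a₄-part w′ e′ ≤ a₃a₄-part (1 + V) 1
    a₃a₄-part-max₁ {V} 2h≡ w′ 0 le _ =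
      a₃a₄-part-mono (3w+e≤2h⇒w≤W {w′} (1 + V) 1 (≤-reflexive (trans 2h≡ (identity₀ V))) (s<s z<s) le) (z≤n {1})
      where
      identity₀ : ∀ V → 4 + 3 * V ≡ 3 * (1 + V) + 1 + 0
      identity₀ = solve-∀
    a₃a₄-part-max₁ {V} 2h≡ w′ 1 le _ =
      a₃a₄-part-mono (3w+e≤2h⇒w≤W {w′} (1 + V) 0 (≤-reflexive (trans 2h≡ (identity₁ V))) z<s le) (≤-refl {1})
      where
      identity₁ : ∀ V → 4 + 3 * V ≡ 3 * (1 + V) + 0 + 1
      identity₁ = solve-∀
    a₃a₄-part-max₁ {V} 2h≡ w′ 2 le _ = begin
      a₃a₄-part w′ 2        ≤⟨ a₃a₄-part-mono
                                 (3w+e≤2h⇒w≤W {w′} V 2 (≤-reflexive (trans 2h≡ (identity₂ V))) (s<s (s<s z<s)) le)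
                                 (≤-refl {2}) ⟩
      a₃a₄-part V 2         ≤⟨ a₃a₄-part-trade₁ V 1 ⟩
      a₃a₄-part (1 + V) 1   ∎
      where
      open ≤-Reasoning
      identity₂ : ∀ V → 4 + 3 * V ≡ 3 * V + 2 + 2
      identity₂ = solve-∀
    a₃a₄-part-max₁ 2h≡ w′ (suc (suc (suc _))) _ (s≤s (s≤s ()))

    a₃a₄-part-max₂ : ∀ {W} → 2 * h ≤ 3 * W + 3 →
      ∀ w′ e′ → 3 * w′ + e′ ≤ 2 * h → e′ ≤ 2 → a₃a₄-part w′ e′ ≤ a₃a₄-part W 2
    a₃a₄-part-max₂ {W} 2h≤ w′ 0 le _ = begin
      a₃a₄-part w′ 0        ≤⟨ a₃a₄-part-mono
                                 (3w+e≤2h⇒w≤W {w′} (1 + W) 0 (≤-trans 2h≤ (≤-reflexive (identity₀ W))) z<s le)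
                                 (≤-refl {0}) ⟩
      a₃a₄-part (1 + W) 0   ≤⟨ a₃a₄-part-trade₂ W 0 ⟩
      a₃a₄-part W 2         ∎
      where
      open ≤-Reasoning
      identity₀ : ∀ W → 3 * W + 3 ≡ 3 * (1 + W) + 0 + 0
      identity₀ = solve-∀
    a₃a₄-part-max₂ {W} 2h≤ w′ 1 le _ =
      a₃a₄-part-mono (3w+e≤2h⇒w≤W {w′} W 2 (≤-trans 2h≤ (≤-reflexive (identity₁ W))) (s<s (s<s z<s)) le)
                     (s≤s (z≤n {1}))
      where
      identity₁ : ∀ W → 3 * W + 3 ≡ 3 * W + 2 + 1
      identity₁ = solve-∀
    a₃a₄-part-max₂ {W} 2h≤ w′ 2 le _ =
      a₃a₄-part-mono (3w+e≤2h⇒w≤W {w′} W 1 (≤-trans 2h≤ (≤-reflexive (identity₂ W))) (s<s z<s) le) (≤-refl {2})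
      where
      identity₂ : ∀ W → 3 * W + 3 ≡ 3 * W + 1 + 2
      identity₂ = solve-∀
    a₃a₄-part-max₂ 2h≤ w′ (suc (suc (suc _))) _ (s≤s (s≤s ()))

    -- F = nf A (h - 1) w e, where (w, e) maximises a₃a₄-part and A is the largest with 3A < 2(h - 1).
    module _ {A c w e : ℕ}
      (A-floor : 2 * (1 + m) ≡ suc (3 * A + c)) (c<3 : c < 3)
      (part-max : ∀ w′ e′ → 3 * w′ + e′ ≤ 2 * h → e′ ≤ 2 → a₃a₄-part w′ e′ ≤ a₃a₄-part w e)
      (short-max≤3F : short-max ≤ 3 * nf A (1 + m) w e)
      where

      3A<2[1+m] : 3 * A < 2 * (1 + m)
      3A<2[1+m] = ≤-trans (s≤s (m≤m+n (3 * A) c)) (≤-reflexive (sym A-floor))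

      A-max : ∀ A′ R → R < h → 3 * A′ < 2 * R → A′ ≤ A
      A-max A′ R R<h 3A′<2R = 3m≤3n+o⇒m≤n (s≤s⁻¹ (begin-strict
        3 * A′             <⟨ 3A′<2R ⟩
        2 * R              ≤⟨ *-monoʳ-≤ 2 (s≤s⁻¹ R<h) ⟩
        2 * (1 + m)        ≡⟨ A-floor ⟩
        suc (3 * A + c)    ∎)) c<3
        where open ≤-Reasoning

      representable-above : ∀ z → nf A (1 + m) w e < z → InS z
      representable-above z F<z with shape z
      ... | below w′ e′ Q β≤2h e′≤2 Q<c = ⊥-elim (<⇒≱ F<z (<⇒≤ (<-≤-trans (below<nf w′ e′ Q<c)
              (+-mono-≤ (part-max w′ e′ β≤2h e′≤2) (*-monoˡ-≤ u (s≤s (z≤n {m + A * h})))))))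
      ... | normal A′ R w′ e′ β≤2h e′≤2 R<h with 3 * A′ <? 2 * R
      ...   | yes 3A′<2R = ⊥-elim (<⇒≱ F<z (+-mono-≤ (part-max w′ e′ β≤2h e′≤2)
              (*-monoˡ-≤ u (+-mono-≤ (s≤s⁻¹ R<h) (*-monoˡ-≤ h (A-max A′ R R<h 3A′<2R))))))
      ...   | no 3A′≮2R with A′ + w′ <? R
      ...     | yes A′+w′<R = ⊥-elim (<⇒≱ F<z (*-cancelˡ-≤ 3
                (≤-trans (3nf≤short-max {A′} {R} {w′} {e′} R<h e′≤2 (≮⇒≥ 3A′≮2R) A′+w′<R) short-max≤3F)))
      ...     | no A′+w′≮R = nf-∈ A′ R w′ e′ (≮⇒≥ 3A′≮2R) (≮⇒≥ A′+w′≮R)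

      frobenius : e ≤ 2 → 3 * w + e < u → IsFrobeniusNumber (S-n (2 * h)) (ℤ.+ nf A (1 + m) w e)
      frobenius e≤2 β<u =
        S-n-even (frobenius-from-ℕ _ (nf-∉ {A} {1 + m} {w} {e} e≤2 β<u ≤-refl 3A<2[1+m]) representable-above)

  module Odd (k : ℕ) where

    g v o₁ o₂ o₃ o₄ : ℕ
    g = 1 + k
    v = 3 + 2 * g
    o₁ = v * g + 1
    o₂ = v * (1 + g)
    o₃ = v * (2 + g)
    o₄ = v * (3 + g) + 1

    S-n-odd : ∀ {F} → IsFrobeniusNumber (InSemigroup4 o₁ o₂ o₃ o₄) F → IsFrobeniusNumber (S-n (2 * g + 1)) F
    S-n-odd = S-n-by-generators {n = 2 * g + 1}
      (2c+n≡n*n⇒nC2≡c (c₁ g)) (2c+n≡n*n⇒nC2≡c (c₂ g)) (2c+n≡n*n⇒nC2≡c (c₃ g)) (2c+n≡n*n⇒nC2≡c (c₄ g))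
      where
      c₁ : ∀ g → 2 * ((3 + 2 * g) * g + 1) + (2 * g + 1 + 1) ≡ (2 * g + 1 + 1) * (2 * g + 1 + 1)
      c₁ = solve-∀
      c₂ : ∀ g → 2 * ((3 + 2 * g) * (1 + g)) + (2 * g + 1 + 2) ≡ (2 * g + 1 + 2) * (2 * g + 1 + 2)
      c₂ = solve-∀
      c₃ : ∀ g → 2 * ((3 + 2 * g) * (2 + g)) + (2 * g + 1 + 3) ≡ (2 * g + 1 + 3) * (2 * g + 1 + 3)
      c₃ = solve-∀
      c₄ : ∀ g → 2 * ((3 + 2 * g) * (3 + g) + 1) + (2 * g + 1 + 4) ≡ (2 * g + 1 + 4) * (2 * g + 1 + 4)
      c₄ = solve-∀

    InS : ℕ → Set
    InS = InSemigroup4ℕ o₁ o₂ o₃ o₄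

    nf : ℕ → ℕ → ℕ
    nf β M = β * o₁ + M * v

    residue-quotient : ∀ x₁ x₂ x₃ x₄ →
      x₁ * o₁ + x₂ * o₂ + x₃ * o₃ + x₄ * o₄ ≡ nf (x₁ + x₄) (x₂ * (1 + g) + x₃ * (2 + g) + x₄ * 3)
    residue-quotient = identity g
      where
      identity : ∀ g x₁ x₂ x₃ x₄ →
        let v = 3 + 2 * g
            o₁ = v * g + 1
        in x₁ * o₁ + x₂ * (v * (1 + g)) + x₃ * (v * (2 + g)) + x₄ * (v * (3 + g) + 1) ≡
           (x₁ + x₄) * o₁ + (x₂ * (1 + g) + x₃ * (2 + g) + x₄ * 3) * v
      identity = solve-∀

    nf-residue-quotient : ∀ β M → nf β M ≡ β + (g * β + M) * v
    nf-residue-quotient β M = identity g β M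
      where
      identity : ∀ g β M → let v = 3 + 2 * g in β * (v * g + 1) + M * v ≡ β + (g * β + M) * v
      identity = solve-∀

    M∉⟨1+g,2+g,3⟩ : ∀ {M} → M < 2 * (1 + g) →
      (∀ z → z * 3 ≢ M) → (∀ z → (1 + g) + z * 3 ≢ M) → (∀ z → (2 + g) + z * 3 ≢ M) →
      ∀ x y z → x * (1 + g) + y * (2 + g) + z * 3 ≢ M
    M∉⟨1+g,2+g,3⟩ M<2[1+g] ≢0 ≢1+g ≢2+g zero zero z eq = ≢0 z eq
    M∉⟨1+g,2+g,3⟩ M<2[1+g] ≢0 ≢1+g ≢2+g 1 zero z eq = ≢1+g z (trans (identity g z) eq)
      where
      identity : ∀ g z → (1 + g) + z * 3 ≡ 1 * (1 + g) + 0 * (2 + g) + z * 3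
      identity = solve-∀
    M∉⟨1+g,2+g,3⟩ M<2[1+g] ≢0 ≢1+g ≢2+g zero 1 z eq = ≢2+g z (trans (identity g z) eq)
      where
      identity : ∀ g z → (2 + g) + z * 3 ≡ 0 * (1 + g) + 1 * (2 + g) + z * 3
      identity = solve-∀
    M∉⟨1+g,2+g,3⟩ M<2[1+g] ≢0 ≢1+g ≢2+g (suc (suc x)) y z eq =
      <⇒≱ M<2[1+g] (m+o≡n⇒m≤n (x * (1 + g) + y * (2 + g) + z * 3) (trans (identity g x y z) eq))
      where
      identity : ∀ g x y z →
        2 * (1 + g) + (x * (1 + g) + y * (2 + g) + z * 3) ≡ (2 + x) * (1 + g) + y * (2 + g) + z * 3
      identity = solve-∀
    M∉⟨1+g,2+g,3⟩ M<2[1+g] ≢0 ≢1+g ≢2+g 1 (suc y) z eq =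
      <⇒≱ M<2[1+g] (m+o≡n⇒m≤n (1 + y * (2 + g) + z * 3) (trans (identity g y z) eq))
      where
      identity : ∀ g y z → 2 * (1 + g) + (1 + y * (2 + g) + z * 3) ≡ 1 * (1 + g) + (1 + y) * (2 + g) + z * 3
      identity = solve-∀
    M∉⟨1+g,2+g,3⟩ M<2[1+g] ≢0 ≢1+g ≢2+g zero (suc (suc y)) z eq =
      <⇒≱ M<2[1+g] (m+o≡n⇒m≤n (2 + y * (2 + g) + z * 3) (trans (identity g y z) eq))
      where
      identity : ∀ g y z → 2 * (1 + g) + (2 + y * (2 + g) + z * 3) ≡ 0 * (1 + g) + (2 + y) * (2 + g) + z * 3
      identity = solve-∀

    nf-∉ : ∀ {β M} → β < v → M < o₁ → (∀ x y z → x * (1 + g) + y * (2 + g) + z * 3 ≢ M) → ¬ InS (nf β M)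
    nf-∉ {β} {M} β<v M<o₁ M-gap (x₁ , x₂ , x₃ , x₄ , eq)
      with residue-or-overflow β<v (trans (sym (nf-residue-quotient (x₁ + x₄) M′))
                                     (trans (sym (residue-quotient x₁ x₂ x₃ x₄)) (trans (sym eq) (nf-residue-quotient β M))))
      where
      M′ = x₂ * (1 + g) + x₃ * (2 + g) + x₄ * 3
    ... | inj₁ (t≡β , I≡Q) =
      M-gap x₂ x₃ x₄ (+-cancelˡ-≡ (g * β) _ _ (trans (cong (λ t → g * t + _) (sym t≡β)) I≡Q))
    ... | inj₂ β+v≤t = <⇒≱ nf<o₁[β+v] (begin
      o₁ * (β + v)                                         ≤⟨ *-monoʳ-≤ o₁ β+v≤t ⟩
      o₁ * (x₁ + x₄)                                       ≤⟨ m+o≡n⇒m≤n _ (cong (_+ M′ * v) (*-comm o₁ (x₁ + x₄))) ⟩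
      nf (x₁ + x₄) M′                                      ≡⟨ residue-quotient x₁ x₂ x₃ x₄ ⟨
      x₁ * o₁ + x₂ * o₂ + x₃ * o₃ + x₄ * o₄                ≡⟨ eq ⟨
      nf β M                                               ∎)
      where
      open ≤-Reasoning
      M′ = x₂ * (1 + g) + x₃ * (2 + g) + x₄ * 3
      nf<o₁[β+v] : nf β M < o₁ * (β + v)
      nf<o₁[β+v] = begin-strict
        β * o₁ + M * v    <⟨ +-monoʳ-< (β * o₁) (*-monoˡ-< v M<o₁) ⟩
        β * o₁ + o₁ * v   ≡⟨ cong (_+ o₁ * v) (*-comm β o₁) ⟩
        o₁ * β + o₁ * v   ≡⟨ *-distribˡ-+ o₁ β v ⟨
        o₁ * (β + v)      ∎

    data Shape : ℕ → Set where
      below  : ∀ β Q → β < v → Q < g * β → Shape (β + Q * v)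
      normal : ∀ β A R → β < v → R ≤ g → Shape (nf β (R + A * (1 + g)))

    shape : ∀ z → Shape z
    shape z = classify {Q = z / v} (m%n<n z v) (m≡m%n+[m/n]*n z v)
      where
      classify : ∀ {z β Q} → β < v → z ≡ β + Q * v → Shape z
      classify {β = β} {Q} β<v refl with g * β ≤? Q
      ... | no gβ≰Q = below β Q β<v (≰⇒> gβ≰Q)
      ... | yes gβ≤Q with m≤n⇒∃[o]m+o≡n gβ≤Q
      ...   | M , refl = subst Shape nf≡z (normal β (M / (1 + g)) (M % (1 + g)) β<v (s≤s⁻¹ (m%n<n M (1 + g))))
        where
        nf≡z : nf β (M % (1 + g) + (M / (1 + g)) * (1 + g)) ≡ β + (g * β + M) * v
        nf≡z = trans (nf-residue-quotient β _) (cong (λ M → β + (g * β + M) * v) (sym (m≡m%n+[m/n]*n M (1 + g))))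

    nf-∈ : ∀ β {M} x₂ x₃ x₄ → x₄ ≤ β → x₂ * (1 + g) + x₃ * (2 + g) + x₄ * 3 ≡ M → InS (nf β M)
    nf-∈ β x₂ x₃ x₄ x₄≤β refl with m≤n⇒∃[o]m+o≡n x₄≤β
    ... | x₁ , refl = x₁ , x₂ , x₃ , x₄ ,
      trans (cong (λ t → nf t (x₂ * (1 + g) + x₃ * (2 + g) + x₄ * 3)) (+-comm x₄ x₁))
            (sym (residue-quotient x₁ x₂ x₃ x₄))

    nf-mono : ∀ {β β′ M M′} → β ≤ β′ → M ≤ M′ → nf β M ≤ nf β′ M′
    nf-mono β≤β′ M≤M′ = +-mono-≤ (*-monoˡ-≤ o₁ β≤β′) (*-monoˡ-≤ v M≤M′)

    below<nf : ∀ {β Q} → Q < g * β → β + Q * v < nf β 1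
    below<nf {β} {Q} Q<gβ = begin-strict
      β + Q * v              <⟨ +-monoʳ-< β (*-monoˡ-< v (m≤n⇒m≤n+o 1 Q<gβ)) ⟩
      β + (g * β + 1) * v    ≡⟨ nf-residue-quotient β 1 ⟨
      nf β 1                 ∎
      where open ≤-Reasoning

    nf≤[2+2g]o₁ : ∀ {β R A} → β ≤ g → R ≤ g → A ≤ g → nf β (R + A * (1 + g)) ≤ (2 + 2 * g) * o₁
    nf≤[2+2g]o₁ {β} {R} {A} β≤g R≤g A≤g = begin
      nf β (R + A * (1 + g))          ≤⟨ nf-mono β≤g (+-mono-≤ R≤g (*-monoˡ-≤ (1 + g) A≤g)) ⟩
      g * o₁ + (g + g * (1 + g)) * v  ≤⟨ m+o≡n⇒m≤n (2 + g) (identity g) ⟩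
      (2 + 2 * g) * o₁                ∎
      where
      open ≤-Reasoning
      identity : ∀ g →
        let v = 3 + 2 * g
            o₁ = v * g + 1
        in g * o₁ + (g + g * (1 + g)) * v + (2 + g) ≡ (2 + 2 * g) * o₁
      identity = solve-∀

    c+j*3≤3β⇒j≤β : ∀ {c j β} → c + j * 3 ≤ 3 * β → j ≤ β
    c+j*3≤3β⇒j≤β {c} {j} {β} le = *-cancelˡ-≤ 3 (≤-trans (≤-reflexive (*-comm 3 j)) (≤-trans (m≤n+m (j * 3) c) le))

    2[1+g]≤o₁ : 2 * (1 + g) ≤ o₁
    2[1+g]≤o₁ = m+o≡n⇒m≤n (2 + 5 * k + 2 * k * k) (identity k)
      where
      identity : ∀ k → 2 * (2 + k) + (2 + 5 * k + 2 * k * k) ≡ (3 + 2 * (1 + k)) * (1 + k) + 1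
      identity = solve-∀

    -- F = (v - 1) o₁ + M₀ v.  The trade argument represents every normal form of a number above
    -- F except those with A = 0 and 3 ∤ R, or A = 1 and R ≡ 2 (mod 3); zero-A and one-A cover them.
    module _ {M₀ : ℕ}
      (zero-A : ∀ j s → 1 ≤ s → s ≤ 2 → s + j * 3 ≤ g → s + j * 3 ≤ M₀)
      (one-A : ∀ β j → β < v → 2 + j * 3 ≤ g →
         InS (nf β (2 + j * 3 + 1 * (1 + g))) ⊎ nf β (2 + j * 3 + 1 * (1 + g)) ≤ nf (2 + 2 * g) M₀)
      where

      nf≤F : ∀ {β M} → β < v → M ≤ M₀ → nf β M ≤ nf (2 + 2 * g) M₀
      nf≤F β<v M≤M₀ = nf-mono (s≤s⁻¹ β<v) M≤M₀

      nf[A+D]-∈-or-≤F : ∀ β A D → β < v → A + D ≤ 3 * β → A + D ≤ g → Mod3 D →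
        InS (nf β (A + D + A * (1 + g))) ⊎ nf β (A + D + A * (1 + g)) ≤ nf (2 + 2 * g) M₀
      nf[A+D]-∈-or-≤F β A _ β<v R≤3β R≤g (3j+0 j) =
        inj₁ (nf-∈ β 0 A j (c+j*3≤3β⇒j≤β {β = β} R≤3β) (identity g A j))
        where
        identity : ∀ g A j → 0 * (1 + g) + A * (2 + g) + j * 3 ≡ A + j * 3 + A * (1 + g)
        identity = solve-∀
      nf[A+D]-∈-or-≤F β zero _ β<v R≤3β R≤g (3j+1 j) =
        inj₂ (nf≤F β<v (≤-trans (≤-reflexive (+-identityʳ _)) (zero-A j 1 ≤-refl (s≤s z≤n) R≤g)))
      nf[A+D]-∈-or-≤F β 1 _ β<v R≤3β R≤g (3j+1 j) = one-A β j β<v R≤g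
      nf[A+D]-∈-or-≤F β (suc (suc a)) _ β<v R≤3β R≤g (3j+1 j) =
        inj₁ (nf-∈ β 2 a (suc j) (c+j*3≤3β⇒j≤β {a} {suc j} {β} (≤-trans (≤-reflexive (shift a j)) R≤3β))
                   (identity g a j))
        where
        shift : ∀ a j → a + (1 + j) * 3 ≡ 2 + a + (1 + j * 3)
        shift = solve-∀
        identity : ∀ g a j → 2 * (1 + g) + a * (2 + g) + (1 + j) * 3 ≡ 2 + a + (1 + j * 3) + (2 + a) * (1 + g)
        identity = solve-∀
      nf[A+D]-∈-or-≤F β zero _ β<v R≤3β R≤g (3j+2 j) =
        inj₂ (nf≤F β<v (≤-trans (≤-reflexive (+-identityʳ _)) (zero-A j 2 (s≤s z≤n) ≤-refl R≤g)))
      nf[A+D]-∈-or-≤F β (suc a) _ β<v R≤3β R≤g (3j+2 j) =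
        inj₁ (nf-∈ β 1 a (suc j) (c+j*3≤3β⇒j≤β {a} {suc j} {β} (≤-trans (≤-reflexive (shift a j)) R≤3β))
                   (identity g a j))
        where
        shift : ∀ a j → a + (1 + j) * 3 ≡ 1 + a + (2 + j * 3)
        shift = solve-∀
        identity : ∀ g a j → 1 * (1 + g) + a * (2 + g) + (1 + j) * 3 ≡ 1 + a + (2 + j * 3) + (1 + a) * (1 + g)
        identity = solve-∀

      nf-∈-or-≤F : ∀ β A R → β < v → R ≤ g →
        InS (nf β (R + A * (1 + g))) ⊎ nf β (R + A * (1 + g)) ≤ nf (2 + 2 * g) M₀
      nf-∈-or-≤F β A R β<v R≤g with R ≤? A
      ... | yes R≤A with m≤n⇒∃[o]m+o≡n R≤A
      ...   | d , refl = inj₁ (nf-∈ β d R 0 z≤n (identity g d R))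
        where
        identity : ∀ g d R → d * (1 + g) + R * (2 + g) + 0 * 3 ≡ R + (R + d) * (1 + g)
        identity = solve-∀
      nf-∈-or-≤F β A R β<v R≤g | no R≰A with 3 * β <? R
      ... | yes 3β<R = inj₂ (≤-trans (nf≤[2+2g]o₁ β≤g R≤g (≤-trans (<⇒≤ (≰⇒> R≰A)) R≤g)) (m≤m+n _ (M₀ * v)))
        where
        β≤g : β ≤ g
        β≤g = ≤-trans (m≤n*m β 3) (≤-trans (<⇒≤ 3β<R) R≤g)
      ... | no 3β≮R with m≤n⇒∃[o]m+o≡n (<⇒≤ (≰⇒> R≰A))
      ...   | D , refl = nf[A+D]-∈-or-≤F β A D β<v (≮⇒≥ 3β≮R) R≤g (mod3 D)

      representable-above : ∀ z → nf (2 + 2 * g) M₀ < z → InS z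
      representable-above z F<z with shape z
      ... | below β Q β<v Q<gβ =
        ⊥-elim (<⇒≱ F<z (<⇒≤ (<-≤-trans (below<nf {β} Q<gβ) (nf≤F β<v (zero-A 0 1 ≤-refl (s≤s z≤n) (s≤s z≤n))))))
      ... | normal β A R β<v R≤g with nf-∈-or-≤F β A R β<v R≤g
      ...   | inj₁ z∈S = z∈S
      ...   | inj₂ z≤F = ⊥-elim (<⇒≱ F<z z≤F)

      frobenius : M₀ < 2 * (1 + g) →
        (∀ z → z * 3 ≢ M₀) → (∀ z → (1 + g) + z * 3 ≢ M₀) → (∀ z → (2 + g) + z * 3 ≢ M₀) →
        IsFrobeniusNumber (S-n (2 * g + 1)) (ℤ.+ nf (2 + 2 * g) M₀)
      frobenius M₀<2[1+g] ≢0 ≢1+g ≢2+g = S-n-odd (frobenius-from-ℕ _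
        (nf-∉ ≤-refl (<-≤-trans M₀<2[1+g] 2[1+g]≤o₁) (M∉⟨1+g,2+g,3⟩ M₀<2[1+g] ≢0 ≢1+g ≢2+g))
        representable-above)


  -- 17 ≡ 2 (mod 3), while 3, 6, 15 ≡ 0 and 10 ≡ 1: so x₃ ≥ 2, and then the sum is at least 20.
  17∉⟨3,6,10,15⟩ : ¬ InSemigroup4ℕ 3 6 10 15 17
  17∉⟨3,6,10,15⟩ (x₁ , x₂ , 0 , x₄ , eq) =
    remainder-mismatch {b = 3} {q = 5} {q′ = x₁ + 2 * x₂ + 5 * x₄} (s<s (s<s z<s)) z<s (λ ())
      (trans eq (identity x₁ x₂ x₄))
    where
    identity : ∀ x₁ x₂ x₄ → x₁ * 3 + x₂ * 6 + 0 * 10 + x₄ * 15 ≡ (x₁ + 2 * x₂ + 5 * x₄) * 3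
    identity = solve-∀
  17∉⟨3,6,10,15⟩ (x₁ , x₂ , 1 , x₄ , eq) =
    remainder-mismatch {b = 3} {q = 5} {q′ = 3 + x₁ + 2 * x₂ + 5 * x₄} (s<s (s<s z<s)) (s<s z<s) (λ ())
      (trans eq (identity x₁ x₂ x₄))
    where
    identity : ∀ x₁ x₂ x₄ → x₁ * 3 + x₂ * 6 + 1 * 10 + x₄ * 15 ≡ 1 + (3 + x₁ + 2 * x₂ + 5 * x₄) * 3
    identity = solve-∀
  17∉⟨3,6,10,15⟩ (x₁ , x₂ , suc (suc x₃) , x₄ , eq) =
    <⇒≱ (m<m+n 17 {3} z<s)
      (m+o≡n⇒m≤n {20} {17} (x₁ * 3 + x₂ * 6 + x₃ * 10 + x₄ * 15) (trans (identity x₁ x₂ x₃ x₄) (sym eq)))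
    where
    identity : ∀ x₁ x₂ x₃ x₄ →
      20 + (x₁ * 3 + x₂ * 6 + x₃ * 10 + x₄ * 15) ≡ x₁ * 3 + x₂ * 6 + (2 + x₃) * 10 + x₄ * 15
    identity = solve-∀

  frobenius-2 : IsFrobeniusNumber (S-n 2) (ℤ.+ 17)
  frobenius-2 = S-n-by-generators {n = 2} refl refl refl refl
    (frobenius-from-ℕ 17 17∉⟨3,6,10,15⟩ (representable-after-run 17 run))
    where
    run : ∀ r → r < 3 → InSemigroup4ℕ 3 6 10 15 (18 + r)
    run 0 _ = 6 , 0 , 0 , 0 , refl
    run 1 _ = 3 , 0 , 1 , 0 , refl
    run 2 _ = 0 , 0 , 2 , 0 , refl
    run (suc (suc (suc _))) (s<s (s<s (s<s ())))

  module Case-6p+4 (p : ℕ) where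
    open Even (3 * p)

    F : ℕ
    F = nf (2 * p) (1 + 3 * p) (1 + 2 * p) 1

    frobenius-6p+4 : IsFrobeniusNumber (S-n (4 + p * 6)) (ℤ.+ F)
    frobenius-6p+4 = subst (λ n → IsFrobeniusNumber (S-n n) (ℤ.+ F)) (n≡2h p)
      (frobenius {2 * p} {1} {1 + 2 * p} {1} (A-floor p) (s<s z<s) (a₃a₄-part-max₁ {2 * p} (2h≡ p))
        (m+o≡n⇒m≤n {short-max} {3 * F} (54 * p * p * p + 135 * p * p + 102 * p + 21) (short-max-slack p))
        (s≤s z≤n) (≤-reflexive (β<u p)))
      where
      n≡2h : ∀ p → 2 * (2 + 3 * p) ≡ 4 + p * 6
      n≡2h = solve-∀
      A-floor : ∀ p → 2 * (1 + 3 * p) ≡ suc (3 * (2 * p) + 1)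
      A-floor = solve-∀
      2h≡ : ∀ p → 2 * (2 + 3 * p) ≡ 4 + 3 * (2 * p)
      2h≡ = solve-∀
      β<u : ∀ p → suc (3 * (1 + 2 * p) + 1) ≡ 1 + 2 * (2 + 3 * p)
      β<u = solve-∀
      short-max-slack : ∀ p →
        let m = 3 * p
            h = 2 + m
            u = 1 + 2 * h
            a₃ = u * (2 + h) + 1
            a₄ = u * (3 + h) + 3
        in 6 * a₃ + m * (3 * u + 3) + 3 * ((1 + m + m * h) * u) + (54 * p * p * p + 135 * p * p + 102 * p + 21) ≡
           3 * (1 * a₃ + (1 + 2 * p) * a₄ + (1 + m + 2 * p * h) * u)
      short-max-slack = solve-∀

    formula-6p+4 : let n = 4 + p * 6 in 6 * F ≡ 2 * n * n * n + 9 * n * n + 13 * n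
    formula-6p+4 = identity p
      where
      identity : ∀ p →
        let h = 2 + 3 * p
            u = 1 + 2 * h
            a₃ = u * (2 + h) + 1
            a₄ = u * (3 + h) + 3
            n = 4 + p * 6
        in 6 * (1 * a₃ + (1 + 2 * p) * a₄ + (1 + 3 * p + 2 * p * h) * u) ≡ 2 * n * n * n + 9 * n * n + 13 * n
      identity = solve-∀

  module Case-6p+6 (p : ℕ) where
    open Even (1 + 3 * p)

    F : ℕ
    F = nf (1 + 2 * p) (1 + (1 + 3 * p)) (1 + 2 * p) 2

    frobenius-6p+6 : IsFrobeniusNumber (S-n (6 + p * 6)) (ℤ.+ F)
    frobenius-6p+6 = subst (λ n → IsFrobeniusNumber (S-n n) (ℤ.+ F)) (n≡2h p)
      (frobenius {1 + 2 * p} {0} {1 + 2 * p} {2} (A-floor p) z<s (a₃a₄-part-max₂ {1 + 2 * p} (≤-reflexive (2h≡ p)))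
        (m+o≡n⇒m≤n {short-max} {3 * F} (54 * p * p * p + 225 * p * p + 288 * p + 111) (short-max-slack p))
        (s≤s (s≤s z≤n)) (m+o≡n⇒m≤n {suc (3 * (1 + 2 * p) + 2)} {u} 1 (β<u p)))
      where
      n≡2h : ∀ p → 2 * (2 + (1 + 3 * p)) ≡ 6 + p * 6
      n≡2h = solve-∀
      A-floor : ∀ p → 2 * (1 + (1 + 3 * p)) ≡ suc (3 * (1 + 2 * p) + 0)
      A-floor = solve-∀
      2h≡ : ∀ p → 2 * (2 + (1 + 3 * p)) ≡ 3 * (1 + 2 * p) + 3
      2h≡ = solve-∀
      β<u : ∀ p → suc (3 * (1 + 2 * p) + 2) + 1 ≡ 1 + 2 * (2 + (1 + 3 * p))
      β<u = solve-∀
      short-max-slack : ∀ p →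
        let m = 1 + 3 * p
            h = 2 + m
            u = 1 + 2 * h
            a₃ = u * (2 + h) + 1
            a₄ = u * (3 + h) + 3
        in 6 * a₃ + m * (3 * u + 3) + 3 * ((1 + m + m * h) * u) + (54 * p * p * p + 225 * p * p + 288 * p + 111) ≡
           3 * (2 * a₃ + (1 + 2 * p) * a₄ + (1 + m + (1 + 2 * p) * h) * u)
      short-max-slack = solve-∀

    formula-6p+6 : let n = 6 + p * 6 in 6 * F + 6 ≡ 2 * n * n * n + 11 * n * n + 15 * n
    formula-6p+6 = identity p
      where
      identity : ∀ p →
        let m = 1 + 3 * p
            h = 2 + m
            u = 1 + 2 * h
            a₃ = u * (2 + h) + 1
            a₄ = u * (3 + h) + 3
            n = 6 + p * 6
        in 6 * (2 * a₃ + (1 + 2 * p) * a₄ + (1 + m + (1 + 2 * p) * h) * u) + 6 ≡ 2 * n * n * n + 11 * n * n + 15 * n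
      identity = solve-∀

  module Case-6p+8 (p : ℕ) where
    open Even (2 + 3 * p)

    F : ℕ
    F = nf (1 + 2 * p) (1 + (2 + 3 * p)) (2 + 2 * p) 2

    frobenius-6p+8 : IsFrobeniusNumber (S-n (8 + p * 6)) (ℤ.+ F)
    frobenius-6p+8 = subst (λ n → IsFrobeniusNumber (S-n n) (ℤ.+ F)) (n≡2h p)
      (frobenius {1 + 2 * p} {2} {2 + 2 * p} {2} (A-floor p) (s<s (s<s z<s))
        (a₃a₄-part-max₂ {2 + 2 * p} (m+o≡n⇒m≤n {2 * h} {3 * (2 + 2 * p) + 3} 1 (2h≡ p)))
        (m+o≡n⇒m≤n {short-max} {3 * F} (54 * p * p * p + 261 * p * p + 423 * p + 228) (short-max-slack p))
        (s≤s (s≤s z≤n)) (≤-reflexive (β<u p)))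
      where
      n≡2h : ∀ p → 2 * (2 + (2 + 3 * p)) ≡ 8 + p * 6
      n≡2h = solve-∀
      A-floor : ∀ p → 2 * (1 + (2 + 3 * p)) ≡ suc (3 * (1 + 2 * p) + 2)
      A-floor = solve-∀
      2h≡ : ∀ p → 2 * (2 + (2 + 3 * p)) + 1 ≡ 3 * (2 + 2 * p) + 3
      2h≡ = solve-∀
      β<u : ∀ p → suc (3 * (2 + 2 * p) + 2) ≡ 1 + 2 * (2 + (2 + 3 * p))
      β<u = solve-∀
      short-max-slack : ∀ p →
        let m = 2 + 3 * p
            h = 2 + m
            u = 1 + 2 * h
            a₃ = u * (2 + h) + 1
            a₄ = u * (3 + h) + 3
        in 6 * a₃ + m * (3 * u + 3) + 3 * ((1 + m + m * h) * u) + (54 * p * p * p + 261 * p * p + 423 * p + 228) ≡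
           3 * (2 * a₃ + (2 + 2 * p) * a₄ + (1 + m + (1 + 2 * p) * h) * u)
      short-max-slack = solve-∀

    formula-6p+8 : let n = 8 + p * 6 in 6 * F ≡ 2 * n * n * n + 10 * n * n + 20 * n + 6
    formula-6p+8 = identity p
      where
      identity : ∀ p →
        let m = 2 + 3 * p
            h = 2 + m
            u = 1 + 2 * h
            a₃ = u * (2 + h) + 1
            a₄ = u * (3 + h) + 3
            n = 8 + p * 6
        in 6 * (2 * a₃ + (2 + 2 * p) * a₄ + (1 + m + (1 + 2 * p) * h) * u) ≡ 2 * n * n * n + 10 * n * n + 20 * n + 6
      identity = solve-∀

  module Case-6p+3 (p : ℕ) where
    open Odd (3 * p)

    -- M₀ = 2g - 1 is the Frobenius number of ⟨3, g + 1⟩, as 3 ∣ g + 2.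
    M₀ F : ℕ
    M₀ = 1 + 6 * p
    F = nf (2 + 2 * g) M₀

    zero-A : ∀ j s → 1 ≤ s → s ≤ 2 → s + j * 3 ≤ g → s + j * 3 ≤ M₀
    zero-A j s _ _ le = ≤-trans le (s≤s (*-monoˡ-≤ p (s≤s (s≤s (s≤s (z≤n {3}))))))

    one-A : ∀ β j → β < v → 2 + j * 3 ≤ g →
      InS (nf β (2 + j * 3 + 1 * (1 + g))) ⊎ nf β (2 + j * 3 + 1 * (1 + g)) ≤ F
    one-A β j β<v le = inj₂ (nf-mono (s≤s⁻¹ β<v) (begin
      2 + j * 3 + 1 * (1 + g)      ≡⟨ identity₁ p j ⟩
      (1 + j) * 3 + (1 + 3 * p)    ≤⟨ +-monoˡ-≤ (1 + 3 * p) (*-monoˡ-≤ 3 j<p) ⟩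
      p * 3 + (1 + 3 * p)          ≡⟨ identity₂ p ⟩
      M₀                           ∎))
      where
      open ≤-Reasoning
      j<p : j < p
      j<p = *-cancelʳ-< 3 j p (≤-trans (s≤s⁻¹ le) (≤-reflexive (*-comm 3 p)))
      identity₁ : ∀ p j → 2 + j * 3 + 1 * (1 + (1 + 3 * p)) ≡ (1 + j) * 3 + (1 + 3 * p)
      identity₁ = solve-∀
      identity₂ : ∀ p → p * 3 + (1 + 3 * p) ≡ 1 + 6 * p
      identity₂ = solve-∀

    frobenius-6p+3 : IsFrobeniusNumber (S-n (3 + p * 6)) (ℤ.+ F)
    frobenius-6p+3 = subst (λ n → IsFrobeniusNumber (S-n n) (ℤ.+ F)) (n≡2g+1 p)
      (frobenius {M₀} zero-A one-A (m+o≡n⇒m≤n {suc M₀} {2 * (1 + g)} 2 (M₀<2[1+g] p))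
        (λ z eq → remainder-mismatch {q = z} {q′ = 2 * p} z<s (s<s z<s) (λ ()) (trans eq (M₀≡ p)))
        (λ z eq → remainder-mismatch {q = p + z} {q′ = 2 * p} (s<s (s<s z<s)) (s<s z<s) (λ ())
                    (trans (1+g≡ p z) (trans eq (M₀≡ p))))
        (λ z eq → remainder-mismatch {q = 1 + p + z} {q′ = 2 * p} z<s (s<s z<s) (λ ())
                    (trans (2+g≡ p z) (trans eq (M₀≡ p)))))
      where
      n≡2g+1 : ∀ p → 2 * (1 + 3 * p) + 1 ≡ 3 + p * 6
      n≡2g+1 = solve-∀
      M₀<2[1+g] : ∀ p → suc (1 + 6 * p) + 2 ≡ 2 * (1 + (1 + 3 * p))
      M₀<2[1+g] = solve-∀
      M₀≡ : ∀ p → 1 + 6 * p ≡ 1 + 2 * p * 3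
      M₀≡ = solve-∀
      1+g≡ : ∀ p z → 2 + (p + z) * 3 ≡ (1 + (1 + 3 * p)) + z * 3
      1+g≡ = solve-∀
      2+g≡ : ∀ p z → (1 + p + z) * 3 ≡ (2 + (1 + 3 * p)) + z * 3
      2+g≡ = solve-∀

    formula-6p+3 : let n = 3 + p * 6 in 6 * F + 24 ≡ 3 * n * n * n + 12 * n * n + 3 * n
    formula-6p+3 = identity p
      where
      identity : ∀ p →
        let g = 1 + 3 * p
            v = 3 + 2 * g
            o₁ = v * g + 1
            n = 3 + p * 6
        in 6 * ((2 + 2 * g) * o₁ + (1 + 6 * p) * v) + 24 ≡ 3 * n * n * n + 12 * n * n + 3 * n
      identity = solve-∀

  module Case-6p+5 (p : ℕ) where
    open Odd (1 + 3 * p)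

    -- M₀ = 2g + 1 is the Frobenius number of ⟨3, g + 2⟩, as 3 ∣ g + 1.
    M₀ F : ℕ
    M₀ = 5 + 6 * p
    F = nf (2 + 2 * g) M₀

    g≤M₀ : g ≤ M₀
    g≤M₀ = m+o≡n⇒m≤n {g} {M₀} (3 + 3 * p) (identity p)
      where
      identity : ∀ p → 1 + (1 + 3 * p) + (3 + 3 * p) ≡ 5 + 6 * p
      identity = solve-∀

    zero-A : ∀ j s → 1 ≤ s → s ≤ 2 → s + j * 3 ≤ g → s + j * 3 ≤ M₀
    zero-A j s _ _ le = ≤-trans le g≤M₀

    one-A : ∀ β j → β < v → 2 + j * 3 ≤ g →
      InS (nf β (2 + j * 3 + 1 * (1 + g))) ⊎ nf β (2 + j * 3 + 1 * (1 + g)) ≤ F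
    one-A β j β<v le = inj₂ (nf-mono (s≤s⁻¹ β<v) (≤-trans (+-monoˡ-≤ (1 * (1 + g)) le) (≤-reflexive (identity p))))
      where
      identity : ∀ p → 1 + (1 + 3 * p) + 1 * (1 + (1 + (1 + 3 * p))) ≡ 5 + 6 * p
      identity = solve-∀

    frobenius-6p+5 : IsFrobeniusNumber (S-n (5 + p * 6)) (ℤ.+ F)
    frobenius-6p+5 = subst (λ n → IsFrobeniusNumber (S-n n) (ℤ.+ F)) (n≡2g+1 p)
      (frobenius {M₀} zero-A one-A (≤-reflexive (M₀<2[1+g] p))
        (λ z eq → remainder-mismatch {q = z} {q′ = 1 + 2 * p} z<s (s<s (s<s z<s)) (λ ()) (trans eq (M₀≡ p)))
        (λ z eq → remainder-mismatch {q = 1 + p + z} {q′ = 1 + 2 * p} z<s (s<s (s<s z<s)) (λ ())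
                    (trans (1+g≡ p z) (trans eq (M₀≡ p))))
        (λ z eq → remainder-mismatch {q = 1 + p + z} {q′ = 1 + 2 * p} (s<s z<s) (s<s (s<s z<s)) (λ ())
                    (trans (2+g≡ p z) (trans eq (M₀≡ p)))))
      where
      n≡2g+1 : ∀ p → 2 * (1 + (1 + 3 * p)) + 1 ≡ 5 + p * 6
      n≡2g+1 = solve-∀
      M₀<2[1+g] : ∀ p → suc (5 + 6 * p) ≡ 2 * (1 + (1 + (1 + 3 * p)))
      M₀<2[1+g] = solve-∀
      M₀≡ : ∀ p → 5 + 6 * p ≡ 2 + (1 + 2 * p) * 3
      M₀≡ = solve-∀
      1+g≡ : ∀ p z → (1 + p + z) * 3 ≡ (1 + (1 + (1 + 3 * p))) + z * 3
      1+g≡ = solve-∀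
      2+g≡ : ∀ p z → 1 + (1 + p + z) * 3 ≡ (2 + (1 + (1 + 3 * p))) + z * 3
      2+g≡ = solve-∀

    formula-6p+5 : let n = 5 + p * 6 in 6 * F ≡ 3 * n * n * n + 12 * n * n + 15 * n
    formula-6p+5 = identity p
      where
      identity : ∀ p →
        let g = 1 + (1 + 3 * p)
            v = 3 + 2 * g
            o₁ = v * g + 1
            n = 5 + p * 6
        in 6 * ((2 + 2 * g) * o₁ + (5 + 6 * p) * v) ≡ 3 * n * n * n + 12 * n * n + 15 * n
      identity = solve-∀

  module Case-6p+7 (p : ℕ) where
    open Odd (2 + 3 * p)

    -- M₀ = g - 1 is the Frobenius number of ⟨3, g + 1, g + 2⟩, as 3 ∣ g.
    M₀ F : ℕ
    M₀ = 2 + 3 * p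
    F = nf (2 + 2 * g) M₀

    j≤p : ∀ {j s} → 1 ≤ s → s + j * 3 ≤ g → j ≤ p
    j≤p {j} {s} 1≤s le = 3m≤3n+o⇒m≤n {j} {p} {2} (begin
      3 * j          ≡⟨ *-comm 3 j ⟩
      j * 3          ≤⟨ s≤s⁻¹ (≤-trans (+-monoˡ-≤ (j * 3) 1≤s) le) ⟩
      2 + 3 * p      ≡⟨ +-comm 2 (3 * p) ⟩
      3 * p + 2      ∎) (s<s (s<s z<s))
      where open ≤-Reasoning

    zero-A : ∀ j s → 1 ≤ s → s ≤ 2 → s + j * 3 ≤ g → s + j * 3 ≤ M₀
    zero-A j s 1≤s s≤2 le = +-mono-≤ s≤2 (≤-trans (≤-reflexive (*-comm j 3)) (*-monoʳ-≤ 3 (j≤p {j} {s} 1≤s le)))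

    M≡3[2+p+j] : ∀ j → 2 + j * 3 + 1 * (1 + g) ≡ (2 + p + j) * 3
    M≡3[2+p+j] j = identity p j
      where
      identity : ∀ p j → 2 + j * 3 + 1 * (1 + (1 + (2 + 3 * p))) ≡ (2 + p + j) * 3
      identity = solve-∀

    one-A : ∀ β j → β < v → 2 + j * 3 ≤ g →
      InS (nf β (2 + j * 3 + 1 * (1 + g))) ⊎ nf β (2 + j * 3 + 1 * (1 + g)) ≤ F
    one-A β j β<v le with 2 + p + j ≤? β
    ... | yes x₄≤β = inj₁ (nf-∈ β 0 0 (2 + p + j) x₄≤β (sym (M≡3[2+p+j] j)))
    ... | no x₄≰β = inj₂ (begin
      nf β (2 + j * 3 + 1 * (1 + g))    ≤⟨ nf-mono β≤1+2p M≤6+6p ⟩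
      nf (1 + 2 * p) (6 + 6 * p)        ≤⟨ m+o≡n⇒m≤n {nf (1 + 2 * p) (6 + 6 * p)} {F}
                                              (72 * p * p * p + 288 * p * p + 376 * p + 160) (identity₂ p) ⟩
      F                                 ∎)
      where
      open ≤-Reasoning
      2+p+j≤2+2p : 2 + p + j ≤ 2 + 2 * p
      2+p+j≤2+2p = ≤-trans (+-monoʳ-≤ (2 + p) (j≤p {j} {2} (s≤s z≤n) le)) (≤-reflexive (identity₁ p))
        where
        identity₁ : ∀ p → 2 + p + p ≡ 2 + 2 * p
        identity₁ = solve-∀
      β≤1+2p : β ≤ 1 + 2 * p
      β≤1+2p = s≤s⁻¹ (≤-trans (≰⇒> x₄≰β) 2+p+j≤2+2p)
      identity₃ : ∀ p → (2 + 2 * p) * 3 ≡ 6 + 6 * p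
      identity₃ = solve-∀
      M≤6+6p : 2 + j * 3 + 1 * (1 + g) ≤ 6 + 6 * p
      M≤6+6p = begin
        2 + j * 3 + 1 * (1 + g)  ≡⟨ M≡3[2+p+j] j ⟩
        (2 + p + j) * 3          ≤⟨ *-monoˡ-≤ 3 2+p+j≤2+2p ⟩
        (2 + 2 * p) * 3          ≡⟨ identity₃ p ⟩
        6 + 6 * p                ∎
      identity₂ : ∀ p →
        let g = 1 + (2 + 3 * p)
            v = 3 + 2 * g
            o₁ = v * g + 1
        in (1 + 2 * p) * o₁ + (6 + 6 * p) * v + (72 * p * p * p + 288 * p * p + 376 * p + 160) ≡
           (2 + 2 * g) * o₁ + (2 + 3 * p) * v
      identity₂ = solve-∀

    frobenius-6p+7 : IsFrobeniusNumber (S-n (7 + p * 6)) (ℤ.+ F)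
    frobenius-6p+7 = subst (λ n → IsFrobeniusNumber (S-n n) (ℤ.+ F)) (n≡2g+1 p)
      (frobenius {M₀} zero-A one-A (m+o≡n⇒m≤n {suc M₀} {2 * (1 + g)} (5 + 3 * p) (M₀<2[1+g] p))
        (λ z eq → remainder-mismatch {q = z} {q′ = p} z<s (s<s (s<s z<s)) (λ ()) (trans eq (M₀≡ p)))
        (λ z eq → remainder-mismatch {q = 1 + p + z} {q′ = p} (s<s z<s) (s<s (s<s z<s)) (λ ())
                    (trans (1+g≡ p z) (trans eq (M₀≡ p))))
        (λ z eq → <⇒≢ (m+o≡n⇒m≤n {suc M₀} {(2 + g) + z * 3} (2 + z * 3) (M₀<2+g p z)) (sym eq)))
      where
      n≡2g+1 : ∀ p → 2 * (1 + (2 + 3 * p)) + 1 ≡ 7 + p * 6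
      n≡2g+1 = solve-∀
      M₀<2[1+g] : ∀ p → suc (2 + 3 * p) + (5 + 3 * p) ≡ 2 * (1 + (1 + (2 + 3 * p)))
      M₀<2[1+g] = solve-∀
      M₀≡ : ∀ p → 2 + 3 * p ≡ 2 + p * 3
      M₀≡ = solve-∀
      1+g≡ : ∀ p z → 1 + (1 + p + z) * 3 ≡ (1 + (1 + (2 + 3 * p))) + z * 3
      1+g≡ = solve-∀
      M₀<2+g : ∀ p z → suc (2 + 3 * p) + (2 + z * 3) ≡ (2 + (1 + (2 + 3 * p))) + z * 3
      M₀<2+g = solve-∀

    formula-6p+7 : let n = 7 + p * 6 in 6 * F + 18 ≡ 3 * n * n * n + 9 * n * n
    formula-6p+7 = identity p
      where
      identity : ∀ p →
        let g = 1 + (2 + 3 * p)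
            v = 3 + 2 * g
            o₁ = v * g + 1
            n = 7 + p * 6
        in 6 * ((2 + 2 * g) * o₁ + (2 + 3 * p) * v) + 18 ≡ 3 * n * n * n + 9 * n * n
      identity = solve-∀

open import Defs
open import Data.Nat as ℕ using (ℕ)
open import Data.Nat.DivMod using (_%_)
open import Data.Integer using (ℤ; +_; _+_; _-_; _*_)
open import Data.Product using (∃; _×_)
open import Relation.Binary.PropositionalEquality using (_≡_)

open import Data.Nat using (zero; suc; s≤s)
open import Data.Nat.DivMod using (_/_; m%n<n; m≡m%n+[m/n]*n; [m+kn]%n≡m%n)
open import Data.Integer as ℤ using (-[1+_])
open import Data.Integer.Properties using (pos-+; pos-*)
open import Data.Integer.Tactic.RingSolver as ℤ-Solver using ()
open import Data.Nat.Tactic.RingSolver as ℕ-Solver using ()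
open import Data.Empty using (⊥)
open import Data.Product using (_,_)
open import Relation.Binary.PropositionalEquality using (refl; sym; trans; cong; cong₂; subst)

Formula : ℕ → ℕ → ℤ → Set
Formula 0 n F = + 6 * F ≡ + 2 * + n * + n * + n + + 11 * + n * + n + + 15 * + n - + 6
Formula 1 n F = + 6 * F ≡ + 3 * + n * + n * + n + + 9 * + n * + n - + 18
Formula 2 n F = + 6 * F ≡ + 2 * + n * + n * + n + + 10 * + n * + n + + 20 * + n + + 6
Formula 3 n F = + 6 * F ≡ + 3 * + n * + n * + n + + 12 * + n * + n + + 3 * + n - + 24
Formula 4 n F = + 6 * F ≡ + 2 * + n * + n * + n + + 9 * + n * + n + + 13 * + n
Formula 5 n F = + 6 * F ≡ + 3 * + n * + n * + n + + 12 * + n * + n + + 15 * + n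
Formula _ _ _ = ⊥

formulas-from-residue : ∀ {n F} r → n % 6 ≡ r → Formula r n F →
  (n % 6 ≡ 0 → Formula 0 n F) × (n % 6 ≡ 2 → Formula 2 n F) × (n % 6 ≡ 4 → Formula 4 n F) ×
  (n % 6 ≡ 1 → Formula 1 n F) × (n % 6 ≡ 3 → Formula 3 n F) × (n % 6 ≡ 5 → Formula 5 n F)
formulas-from-residue {n} {F} r n%6≡r formula = at 0 , at 2 , at 4 , at 1 , at 3 , at 5
  where
  at : ∀ r′ → n % 6 ≡ r′ → Formula r′ n F
  at r′ n%6≡r′ = subst (λ r → Formula r n F) (trans (sym n%6≡r) n%6≡r′) formula

pos-an³+bn² : ∀ a b n → + (a ℕ.* n ℕ.* n ℕ.* n ℕ.+ b ℕ.* n ℕ.* n) ≡ + a * + n * + n * + n + + b * + n * + n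
pos-an³+bn² a b n = trans (pos-+ (a ℕ.* n ℕ.* n ℕ.* n) (b ℕ.* n ℕ.* n)) (cong₂ _+_ pos-an³ (pos-an² b))
  where
  pos-an² : ∀ a → + (a ℕ.* n ℕ.* n) ≡ + a * + n * + n
  pos-an² a = trans (pos-* (a ℕ.* n) n) (cong (_* + n) (pos-* a n))
  pos-an³ : + (a ℕ.* n ℕ.* n ℕ.* n) ≡ + a * + n * + n * + n
  pos-an³ = trans (pos-* (a ℕ.* n ℕ.* n) n) (cong (_* + n) (pos-an² a))

pos-cubic : ∀ a b c n →
  + (a ℕ.* n ℕ.* n ℕ.* n ℕ.+ b ℕ.* n ℕ.* n ℕ.+ c ℕ.* n) ≡ + a * + n * + n * + n + + b * + n * + n + + c * + n
pos-cubic a b c n =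
  trans (pos-+ (a ℕ.* n ℕ.* n ℕ.* n ℕ.+ b ℕ.* n ℕ.* n) (c ℕ.* n)) (cong₂ _+_ (pos-an³+bn² a b n) (pos-* c n))

pos-minus : ∀ x {d y} → x ℕ.+ d ≡ y → + x ≡ + y - + d
pos-minus x {d} refl = trans (identity (+ x) (+ d)) (cong (_- + d) (sym (pos-+ x d)))
  where
  identity : ∀ x d → x ≡ x + d - d
  identity = ℤ-Solver.solve-∀

pos-6* : ∀ {F y} → 6 ℕ.* F ≡ y → + 6 * + F ≡ + y
pos-6* {F} eq = trans (sym (pos-* 6 F)) (cong +_ eq)

pos-6*-minus : ∀ {F y} d → 6 ℕ.* F ℕ.+ d ≡ y → + 6 * + F ≡ + y - + d
pos-6*-minus {F} d eq = trans (sym (pos-* 6 F)) (pos-minus (6 ℕ.* F) eq)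

FrobeniusByResidue : ℕ → Set
FrobeniusByResidue n = ∃ λ r → ∃ λ F → n % 6 ≡ r × IsFrobeniusNumber (S-n n) F × Formula r n F

case-1 : FrobeniusByResidue 1
case-1 = 1 , -[1+ 0 ] , refl , ((λ { (_ , _ , _ , _ , ()) }) , above) , refl
  where
  above : ∀ z → -[1+ 0 ] ℤ.< z → S-n 1 z
  above (+ z) _ = z , 0 , 0 , 0 , cong +_ (identity z)
    where
    identity : ∀ z → z ≡ z ℕ.* 1 ℕ.+ 0 ℕ.* 3 ℕ.+ 0 ℕ.* 6 ℕ.+ 0 ℕ.* 10
    identity = ℕ-Solver.solve-∀
  above -[1+ _ ] (ℤ.-<- ())

case-2 : FrobeniusByResidue 2
case-2 = 2 , + 17 , refl , Frobenius.frobenius-2 , refl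

case-6p+3 : ∀ p → FrobeniusByResidue (3 ℕ.+ p ℕ.* 6)
case-6p+3 p = 3 , + F , [m+kn]%n≡m%n 3 p 6 , frobenius-6p+3 ,
  trans (pos-6*-minus {F} 24 formula-6p+3) (cong (_- + 24) (pos-cubic 3 12 3 (3 ℕ.+ p ℕ.* 6)))
  where open Frobenius.Case-6p+3 p

case-6p+4 : ∀ p → FrobeniusByResidue (4 ℕ.+ p ℕ.* 6)
case-6p+4 p = 4 , + F , [m+kn]%n≡m%n 4 p 6 , frobenius-6p+4 ,
  trans (pos-6* {F} formula-6p+4) (pos-cubic 2 9 13 (4 ℕ.+ p ℕ.* 6))
  where open Frobenius.Case-6p+4 p

case-6p+5 : ∀ p → FrobeniusByResidue (5 ℕ.+ p ℕ.* 6)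
case-6p+5 p = 5 , + F , [m+kn]%n≡m%n 5 p 6 , frobenius-6p+5 ,
  trans (pos-6* {F} formula-6p+5) (pos-cubic 3 12 15 (5 ℕ.+ p ℕ.* 6))
  where open Frobenius.Case-6p+5 p

case-6p+6 : ∀ p → FrobeniusByResidue (6 ℕ.+ p ℕ.* 6)
case-6p+6 p = 0 , + F , [m+kn]%n≡m%n 0 (suc p) 6 , frobenius-6p+6 ,
  trans (pos-6*-minus {F} 6 formula-6p+6) (cong (_- + 6) (pos-cubic 2 11 15 (6 ℕ.+ p ℕ.* 6)))
  where open Frobenius.Case-6p+6 p

case-6p+7 : ∀ p → FrobeniusByResidue (7 ℕ.+ p ℕ.* 6)
case-6p+7 p = 1 , + F , [m+kn]%n≡m%n 1 (suc p) 6 , frobenius-6p+7 ,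
  trans (pos-6*-minus {F} 18 formula-6p+7) (cong (_- + 18) (pos-an³+bn² 3 9 (7 ℕ.+ p ℕ.* 6)))
  where open Frobenius.Case-6p+7 p

case-6p+8 : ∀ p → FrobeniusByResidue (8 ℕ.+ p ℕ.* 6)
case-6p+8 p = 2 , + F , [m+kn]%n≡m%n 2 (suc p) 6 , frobenius-6p+8 ,
  trans (pos-6* {F} formula-6p+8) (trans (pos-+ (2 ℕ.* n ℕ.* n ℕ.* n ℕ.+ 10 ℕ.* n ℕ.* n ℕ.+ 20 ℕ.* n) 6)
    (cong (_+ + 6) (pos-cubic 2 10 20 n)))
  where
  open Frobenius.Case-6p+8 p
  n = 8 ℕ.+ p ℕ.* 6

by-residue : ∀ {n} r p → r ℕ.< 6 → n ≡ r ℕ.+ p ℕ.* 6 → 1 ℕ.≤ n → FrobeniusByResidue n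
by-residue 0 zero _ refl ()
by-residue 0 (suc p) _ refl _ = case-6p+6 p
by-residue 1 zero _ refl _ = case-1
by-residue 1 (suc p) _ refl _ = case-6p+7 p
by-residue 2 zero _ refl _ = case-2
by-residue 2 (suc p) _ refl _ = case-6p+8 p
by-residue 3 p _ refl _ = case-6p+3 p
by-residue 4 p _ refl _ = case-6p+4 p
by-residue 5 p _ refl _ = case-6p+5 p
by-residue (suc (suc (suc (suc (suc (suc _)))))) _ (s≤s (s≤s (s≤s (s≤s (s≤s (s≤s ())))))) _ _

corollary5p1 : (n : ℕ) → 1 ℕ.≤ n →
    ∃ λ (F : ℤ) → IsFrobeniusNumber (S-n n) F ×
      ((n % 6 ≡ 0 → + 6 * F ≡ + 2 * + n * + n * + n + + 11 * + n * + n + + 15 * + n - + 6) ×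
       (n % 6 ≡ 2 → + 6 * F ≡ + 2 * + n * + n * + n + + 10 * + n * + n + + 20 * + n + + 6) ×
       (n % 6 ≡ 4 → + 6 * F ≡ + 2 * + n * + n * + n + + 9 * + n * + n + + 13 * + n) ×
       (n % 6 ≡ 1 → + 6 * F ≡ + 3 * + n * + n * + n + + 9 * + n * + n - + 18) ×
       (n % 6 ≡ 3 → + 6 * F ≡ + 3 * + n * + n * + n + + 12 * + n * + n + + 3 * + n - + 24) ×
       (n % 6 ≡ 5 → + 6 * F ≡ + 3 * + n * + n * + n + + 12 * + n * + n + + 15 * + n))
corollary5p1 n 1≤n with by-residue (n % 6) (n / 6) (m%n<n n 6) (m≡m%n+[m/n]*n n 6) 1≤n
... | r , F , n%6≡r , isFrobenius , formula = F , isFrobenius , formulas-from-residue r n%6≡r formula
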